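{- Let $q=2^m$ with $m\ge 1$, let $E=\mathbb{F}_{q^4}\supset K=\mathbb{F}_{q^2}$, let $\mathcal{P}=\{x\in E \mid x^{q^3+q^2+q+1}=1\}$ and $S=\{x\in K\mid x^{q+1}=1\}$. Let $\beta\in\mathcal{P}$ and $\alpha\in E$ satisfy $\alpha^{q+1}=\beta^q+\beta^{q^2+q+1}$, and let $\lambda\in S$. Then the system of equations $$X^{q+1}+\alpha X+\beta=0,\qquad X^{q^2+1}=\lambda$$ has at most two solutions in $\mathcal{P}$.
   Context: In the cyclic presentation of $PG(3,q)$, the points are the elements of $\mathcal{P}$ and the lines are the zero sets in $\mathcal{P}$ of the polynomials $X^{q+1}+\alpha X+\beta$ with $\beta\in\mathcal{P}$, $\alpha\in E$, $\alpha^{q+1}=\beta^q+\beta^{q^2+q+1}$. The result implies that $\mathcal{O}=\{x\in E\mid x^{q^2+1}=1\}$ (the union over $\lambda\in S$ of the second equation's solution sets being $\mathcal{P}$ and $\lambda=1$ giving $\mathcal{O}$) meets each line in at most two points. -}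

module Defs where

open import Level using (Level; _⊔_)
open import Data.Nat using (ℕ; _^_)
open import Data.Fin using (Fin)
open import Data.Product using (Σ; _×_)
open import Relation.Nullary using (¬_)
import Relation.Binary.PropositionalEquality as ≡
open import Function.Bundles using (Inverse)
open import Algebra.Bundles using (CommutativeRing; Semiring)
import Algebra.Definitions.RawSemiring as RS
import Data.Nat

record IsField {c ℓ : Level} (R : CommutativeRing c ℓ) : Set (c ⊔ ℓ) where
  open CommutativeRing R
  field
    0≉1     : ¬ (0# ≈ 1#)
    inverse : ∀ x → ¬ (x ≈ 0#) → Σ Carrier (λ y → (x * y) ≈ 1#)

record FiniteFieldOfOrder {c ℓ : Level} (R : CommutativeRing c ℓ) (n : ℕ)
       : Set (c ⊔ ℓ) where
  field
    isField     : IsField R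
    enumeration : Inverse (CommutativeRing.setoid R) (≡.setoid (Fin n))

module Setup {c ℓ : Level} (E : CommutativeRing c ℓ) (q : ℕ) where
  open CommutativeRing E
  open RS (Semiring.rawSemiring semiring) public using () renaming (_^_ to _^ᴱ_)

  -- K = F_{q^2} ⊆ E, the subfield { x | x^(q^2) = x }.
  InK : Carrier → Set ℓ
  InK x = (x ^ᴱ (q ^ 2)) ≈ x

  Inℙ : Carrier → Set ℓ
  Inℙ x = (x ^ᴱ (q ^ 3 Data.Nat.+ q ^ 2 Data.Nat.+ q Data.Nat.+ 1)) ≈ 1#

  InS : Carrier → Set ℓ
  InS x = InK x × ((x ^ᴱ (q Data.Nat.+ 1)) ≈ 1#)

  Solution : Carrier → Carrier → Carrier → Carrier → Set ℓ
  Solution α β lam x =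
    Inℙ x
    × (((x ^ᴱ (q Data.Nat.+ 1)) + (α * x) + β) ≈ 0#)
    × ((x ^ᴱ (q ^ 2 Data.Nat.+ 1)) ≈ lam)

{-# OPTIONS --safe #-}
-- A field of even order has characteristic 2, so x ↦ x ^ q and x ↦ x ^ q² are additive.
-- Raising X^(q+1) + αX + β = 0 to the power q², multiplying by X^(q+1) and using
-- X^(q²+1) = λ, λ^(q+1) = 1 eliminates X^(q²) and X^(q³): 1 + α^(q²) λ X^q + β^(q²) X^(q+1) = 0.
-- Eliminating X^q between this and the original equation leaves a quadratic equation
-- for X (for α = 0 the q-th power yields one directly) whose leading coefficient is
-- nonzero because β ≠ 0, and a quadratic over a field has at most two roots.
module Submission where

open import Defs
open import Level using (Level; _⊔_)
open import Data.Nat using (ℕ; _^_; _+_; _≤_)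
open import Data.Product using (_×_)
open import Data.Sum using (_⊎_)
open import Algebra.Bundles using (CommutativeRing)

open import Data.Nat using (zero; suc; NonZero; ≢-nonZero; s≤s; z≤n)
import Data.Nat as ℕ
import Data.Nat.Properties as ℕₚ
open import Data.Fin using (Fin; zero; suc)
import Data.Fin.Properties as Finₚ
open import Data.Product using (_,_; ∃-syntax)
open import Data.Sum using (inj₁; inj₂; [_,_]′; fromInj₂)
open import Function using (_∘_; Inverse)
open import Relation.Nullary using (¬_; Dec; yes; no)
open import Relation.Nullary.Negation using (contradiction)
open import Relation.Binary.Definitions using (Decidable)
import Relation.Binary.PropositionalEquality as ≡
open ≡ using (_≡_; _≢_)
open import Algebra.Definitions using (AlmostLeftCancellative)

module Parity where
  open import Data.Nat using (_*_)
  open import Data.Nat.Properties using (+-0-commutativeMonoid; +-comm; +-identityʳ; even≢odd)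
  open import Data.Fin.Properties using (_≟_; _≤?_; ≤-antisym; ≤-total; ≤-reflexive; suc-injective)
  open import Data.Fin.Permutation using (permutation)
  open import Algebra.Properties.CommutativeMonoid.Sum +-0-commutativeMonoid
    using (sum; sum-permute; ∑-distrib-+; sum-cong-≗; sum-replicate-zero)
  open ≡ using (refl; sym; trans; cong; cong₂)

  𝟙[_] : ∀ {p} {P : Set p} → Dec P → ℕ
  𝟙[ yes _ ] = 1
  𝟙[ no _ ] = 0

  𝟙[≤]+𝟙[≥] : ∀ {n} (i j : Fin n) → 𝟙[ i ≤? j ] + 𝟙[ j ≤? i ] ≡ 1 + 𝟙[ i ≟ j ]
  𝟙[≤]+𝟙[≥] i j with i ≤? j | j ≤? i | i ≟ j
  ... | yes _   | yes _   | yes _   = refl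
  ... | yes _   | no _    | no _    = refl
  ... | no _    | yes _   | no _    = refl
  ... | yes i≤j | yes j≤i | no i≢j  = contradiction (≤-antisym i≤j j≤i) i≢j
  ... | yes _   | no j≰i  | yes i≡j = contradiction (≤-reflexive (sym i≡j)) j≰i
  ... | no i≰j  | _       | yes i≡j = contradiction (≤-reflexive i≡j) i≰j
  ... | no i≰j  | no j≰i  | no _    =
    [ (λ i≤j → contradiction i≤j i≰j) , (λ j≤i → contradiction j≤i j≰i) ]′ (≤-total i j)

  sum-const-1 : ∀ n → sum {n} (λ _ → 1) ≡ n
  sum-const-1 zero    = refl
  sum-const-1 (suc n) = cong suc (sum-const-1 n)

  sum-unit-vector : ∀ {n} (e : Fin n → ℕ) i₀ → e i₀ ≡ 1 → (∀ i → i ≢ i₀ → e i ≡ 0) → sum e ≡ 1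
  sum-unit-vector {suc n} e zero eᵢ₀≡1 e≡0 =
    cong₂ _+_ eᵢ₀≡1 (trans (sum-cong-≗ {n} λ i → e≡0 (suc i) λ ()) (sum-replicate-zero n))
  sum-unit-vector e (suc i₀) eᵢ₀≡1 e≡0 =
    cong₂ _+_ (e≡0 zero λ ())
      (sum-unit-vector (e ∘ suc) i₀ eᵢ₀≡1 λ i i≢i₀ → e≡0 (suc i) (i≢i₀ ∘ suc-injective))

  involution-with-unique-fixed-point⇒odd :
    ∀ {N} (f : Fin N → Fin N) → (∀ i → f (f i) ≡ i) →
    ∀ i₀ → f i₀ ≡ i₀ → (∀ i → f i ≡ i → i ≡ i₀) → ∀ k → N ≢ 2 * k
  involution-with-unique-fixed-point⇒odd {N} f f∘f≡id i₀ fi₀≡i₀ fixed⇒≡i₀ k N≡2k =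
    even≢odd (sum below) k (trans 2*Σbelow≡1+N (cong suc N≡2k))
    where
    below above fixed : Fin N → ℕ
    below i = 𝟙[ f i ≤? i ]
    above i = 𝟙[ i ≤? f i ]
    fixed i = 𝟙[ f i ≟ i ]

    Σbelow≡Σabove : sum below ≡ sum above
    Σbelow≡Σabove = trans (sum-permute below (permutation f f f∘f≡id f∘f≡id)) (sum-cong-≗ below∘f≗above)
      where
      below∘f≗above : ∀ i → below (f i) ≡ above i
      below∘f≗above i rewrite f∘f≡id i = refl

    Σfixed≡1 : sum fixed ≡ 1
    Σfixed≡1 = sum-unit-vector fixed i₀ fixedᵢ₀ fixed≡0
      where
      fixedᵢ₀ : fixed i₀ ≡ 1
      fixedᵢ₀ with f i₀ ≟ i₀
      ... | yes _  = refl
      ... | no fi₀≢i₀ = contradiction fi₀≡i₀ fi₀≢i₀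
      fixed≡0 : ∀ i → i ≢ i₀ → fixed i ≡ 0
      fixed≡0 i i≢i₀ with f i ≟ i
      ... | yes fi≡i = contradiction (fixed⇒≡i₀ i fi≡i) i≢i₀
      ... | no _     = refl

    2*Σbelow≡1+N : 2 * sum below ≡ suc N
    2*Σbelow≡1+N = begin
      2 * sum below                  ≡⟨ cong (sum below +_) (+-identityʳ (sum below)) ⟩
      sum below + sum below          ≡⟨ cong (sum below +_) Σbelow≡Σabove ⟩
      sum below + sum above          ≡⟨ ∑-distrib-+ below above ⟨
      sum (λ i → below i + above i)  ≡⟨ sum-cong-≗ (λ i → 𝟙[≤]+𝟙[≥] (f i) i) ⟩
      sum (λ i → 1 + fixed i)        ≡⟨ ∑-distrib-+ (λ _ → 1) fixed ⟩
      sum {N} (λ _ → 1) + sum fixed  ≡⟨ cong₂ _+_ (sum-const-1 N) Σfixed≡1 ⟩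
      N + 1                          ≡⟨ +-comm N 1 ⟩
      suc N                          ∎
      where open ≡.≡-Reasoning

Characteristic2 : ∀ {r ℓ} → CommutativeRing r ℓ → Set ℓ
Characteristic2 R = 1# ⊕ 1# ≈ 0#
  where open CommutativeRing R renaming (_+_ to _⊕_)

record IsIntegralDomain {r ℓ} (R : CommutativeRing r ℓ) : Set (r ⊔ ℓ) where
  open CommutativeRing R
  field
    0≉1          : ¬ 0# ≈ 1#
    zero-product : ∀ x y → x * y ≈ 0# → x ≈ 0# ⊎ y ≈ 0#

module RingProperties {r ℓ} (R : CommutativeRing r ℓ) where
  open CommutativeRing R renaming (_+_ to _⊕_)
  open import Algebra.Properties.Semiring.Exp semiring public
    using (^-congˡ; ^-congʳ; ^-homo-*; ^-assocʳ) renaming (_^_ to _^ᴱ_)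
  open import Algebra.Properties.CommutativeSemiring.Exp commutativeSemiring public
    using (^-distrib-*)
  open import Relation.Binary.Reasoning.Setoid setoid

  x^[n+1]≈x^n*x : ∀ x n → x ^ᴱ (n + 1) ≈ x ^ᴱ n * x
  x^[n+1]≈x^n*x x n = trans (^-homo-* x n 1) (*-congˡ (*-identityʳ x))

  ^-comm-^ : ∀ x m n → (x ^ᴱ m) ^ᴱ n ≈ (x ^ᴱ n) ^ᴱ m
  ^-comm-^ x m n = begin
    (x ^ᴱ m) ^ᴱ n    ≈⟨ ^-assocʳ x m n ⟩
    x ^ᴱ (m ℕ.* n)   ≡⟨ ≡.cong (x ^ᴱ_) (ℕₚ.*-comm m n) ⟩
    x ^ᴱ (n ℕ.* m)   ≈⟨ ^-assocʳ x n m ⟨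
    (x ^ᴱ n) ^ᴱ m    ∎

  x≈0⇒x^n≈0 : ∀ {x} n .{{_ : NonZero n}} → x ≈ 0# → x ^ᴱ n ≈ 0#
  x≈0⇒x^n≈0 (suc n) x≈0 = trans (*-congʳ x≈0) (zeroˡ _)

  IsRoot : Carrier → Carrier → Carrier → Carrier → Set ℓ
  IsRoot a b c x = a * (x * x) ⊕ b * x ⊕ c ≈ 0#

module IntegralDomainProperties {r ℓ} {R : CommutativeRing r ℓ} (R-domain : IsIntegralDomain R) where
  open CommutativeRing R renaming (_+_ to _⊕_)
  open IsIntegralDomain R-domain
  open RingProperties R
  open import Algebra.Properties.Ring ring using (x[y-z]≈xy-xz; x≈y⇒x∙y⁻¹≈ε; x∙y⁻¹≈ε⇒x≈y)

  x≉0∧y≉0⇒x*y≉0 : ∀ {x y} → ¬ x ≈ 0# → ¬ y ≈ 0# → ¬ x * y ≈ 0#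
  x≉0∧y≉0⇒x*y≉0 x≉0 y≉0 xy≈0 = [ x≉0 , y≉0 ]′ (zero-product _ _ xy≈0)

  x^n≈1⇒x≉0 : ∀ {x} n .{{_ : NonZero n}} → x ^ᴱ n ≈ 1# → ¬ x ≈ 0#
  x^n≈1⇒x≉0 n x^n≈1 x≈0 = 0≉1 (trans (sym (x≈0⇒x^n≈0 n x≈0)) x^n≈1)

  x≉0⇒x^n≉0 : ∀ {x} n → ¬ x ≈ 0# → ¬ x ^ᴱ n ≈ 0#
  x≉0⇒x^n≉0 zero    x≉0 1≈0 = 0≉1 (sym 1≈0)
  x≉0⇒x^n≉0 (suc n) x≉0     = x≉0∧y≉0⇒x*y≉0 x≉0 (x≉0⇒x^n≉0 n x≉0)

  *-almostCancelˡ : AlmostLeftCancellative _≈_ 0# _*_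
  *-almostCancelˡ a x y a≉0 ax≈ay =
    x∙y⁻¹≈ε⇒x≈y x y (fromInj₂ (λ a≈0 → contradiction a≈0 a≉0) (zero-product a (x - y) a[x-y]≈0))
    where
    a[x-y]≈0 : a * (x - y) ≈ 0#
    a[x-y]≈0 = trans (x[y-z]≈xy-xz a x y) (x≈y⇒x∙y⁻¹≈ε ax≈ay)

module FiniteFieldProperties {r ℓ} {F : CommutativeRing r ℓ} {N : ℕ} (F-finite : FiniteFieldOfOrder F N) where
  open CommutativeRing F renaming (_+_ to _⊕_)
  open FiniteFieldOfOrder F-finite
  open IsField isField
  open Inverse enumeration using (to; from; to-cong; from-cong; strictlyInverseˡ; strictlyInverseʳ)
  open import Algebra.Properties.Ring ring using (-‿involutive; -0#≈0#)
  open import Relation.Binary.Reasoning.Setoid setoid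
  open Parity using (involution-with-unique-fixed-point⇒odd)

  _≟_ : Decidable _≈_
  x ≟ y with to x Finₚ.≟ to y
  ... | yes tx≡ty = yes (trans (sym (strictlyInverseʳ x)) (trans (from-cong tx≡ty) (strictlyInverseʳ y)))
  ... | no  tx≢ty = no (tx≢ty ∘ to-cong)

  x≉0∧x*y≈0⇒y≈0 : ∀ {x y} → ¬ x ≈ 0# → x * y ≈ 0# → y ≈ 0#
  x≉0∧x*y≈0⇒y≈0 {x} {y} x≉0 xy≈0 with inverse x x≉0
  ... | x⁻¹ , xx⁻¹≈1 = begin
    y                ≈⟨ *-identityˡ y ⟨
    1# * y           ≈⟨ *-congʳ (trans (sym xx⁻¹≈1) (*-comm x x⁻¹)) ⟩
    (x⁻¹ * x) * y    ≈⟨ *-assoc x⁻¹ x y ⟩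
    x⁻¹ * (x * y)    ≈⟨ *-congˡ xy≈0 ⟩
    x⁻¹ * 0#         ≈⟨ zeroʳ x⁻¹ ⟩
    0#               ∎

  isIntegralDomain : IsIntegralDomain F
  isIntegralDomain = record { 0≉1 = 0≉1 ; zero-product = zero-product }
    where
    zero-product : ∀ x y → x * y ≈ 0# → x ≈ 0# ⊎ y ≈ 0#
    zero-product x y xy≈0 with x ≟ 0#
    ... | yes x≈0 = inj₁ x≈0
    ... | no  x≉0 = inj₂ (x≉0∧x*y≈0⇒y≈0 x≉0 xy≈0)

  -- Otherwise negation would be an involution of the N elements fixing only 0.
  even-order⇒characteristic2 : ∀ k → N ≡ 2 ℕ.* k → Characteristic2 F
  even-order⇒characteristic2 k N≡2k with (1# ⊕ 1#) ≟ 0#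
  ... | yes 2≈0 = 2≈0
  ... | no  2≉0 = contradiction N≡2k
    (involution-with-unique-fixed-point⇒odd neg neg∘neg≡id (to 0#) neg-fixes-0 fixed⇒0 k)
    where
    neg : Fin N → Fin N
    neg i = to (- from i)
    neg∘neg≡id : ∀ i → neg (neg i) ≡ i
    neg∘neg≡id i = ≡.trans
      (to-cong (trans (-‿cong (strictlyInverseʳ (- from i))) (-‿involutive (from i))))
      (strictlyInverseˡ i)
    neg-fixes-0 : neg (to 0#) ≡ to 0#
    neg-fixes-0 = to-cong (trans (-‿cong (strictlyInverseʳ 0#)) -0#≈0#)
    fixed⇒0 : ∀ i → neg i ≡ i → i ≡ to 0#
    fixed⇒0 i negi≡i = ≡.trans (≡.sym (strictlyInverseˡ i)) (to-cong a≈0)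
      where
      a : Carrier
      a = from i
      -a≈a : - a ≈ a
      -a≈a = trans (sym (strictlyInverseʳ (- a))) (from-cong negi≡i)
      a≈0 : a ≈ 0#
      a≈0 = x≉0∧x*y≈0⇒y≈0 2≉0 (begin
        (1# ⊕ 1#) * a      ≈⟨ distribʳ a 1# 1# ⟩
        1# * a ⊕ 1# * a    ≈⟨ +-cong (*-identityˡ a) (*-identityˡ a) ⟩
        a ⊕ a              ≈⟨ +-congˡ -a≈a ⟨
        a ⊕ - a            ≈⟨ -‿inverseʳ a ⟩
        0#                 ∎)

module Characteristic2Properties {r ℓ} (R : CommutativeRing r ℓ) (char2 : Characteristic2 R) where
  open CommutativeRing R renaming (_+_ to _⊕_)
  open RingProperties R
  open import Algebra.Properties.Ring ring using (+-cancelˡ; +-cancelʳ)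
  open import Algebra.Solver.Ring.NaturalCoefficients.Default commutativeSemiring
    using (solve; _:+_; _:*_; _:=_; con)
  open import Relation.Binary.Reasoning.Setoid setoid

  x⊕x≈0 : ∀ x → x ⊕ x ≈ 0#
  x⊕x≈0 x = begin
    x ⊕ x              ≈⟨ +-cong (*-identityˡ x) (*-identityˡ x) ⟨
    1# * x ⊕ 1# * x    ≈⟨ distribʳ x 1# 1# ⟨
    (1# ⊕ 1#) * x      ≈⟨ *-congʳ char2 ⟩
    0# * x             ≈⟨ zeroˡ x ⟩
    0#                 ∎

  x⊕[y⊕y]≈x : ∀ x y → x ⊕ (y ⊕ y) ≈ x
  x⊕[y⊕y]≈x x y = trans (+-congˡ (x⊕x≈0 y)) (+-identityʳ x)

  ≈-modulo-doubles : ∀ {u v} x y → u ⊕ (x ⊕ x) ≈ v ⊕ (y ⊕ y) → u ≈ v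
  ≈-modulo-doubles {u} {v} x y eq = trans (sym (x⊕[y⊕y]≈x u x)) (trans eq (x⊕[y⊕y]≈x v y))

  x⊕y≈0⇒x≈y : ∀ {x y} → x ⊕ y ≈ 0# → x ≈ y
  x⊕y≈0⇒x≈y {x} {y} x⊕y≈0 = begin
    x              ≈⟨ x⊕[y⊕y]≈x x y ⟨
    x ⊕ (y ⊕ y)    ≈⟨ +-assoc x y y ⟨
    (x ⊕ y) ⊕ y    ≈⟨ +-congʳ x⊕y≈0 ⟩
    0# ⊕ y         ≈⟨ +-identityˡ y ⟩
    y              ∎

  Additive : ℕ → Set (r ⊔ ℓ)
  Additive n = ∀ x y → (x ⊕ y) ^ᴱ n ≈ x ^ᴱ n ⊕ y ^ᴱ n

  additive-1 : Additive 1
  additive-1 x y = trans (*-identityʳ (x ⊕ y)) (sym (+-cong (*-identityʳ x) (*-identityʳ y)))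

  additive-2 : Additive 2
  additive-2 x y = trans expand (x⊕[y⊕y]≈x _ (x * y))
    where
    expand : (x ⊕ y) ^ᴱ 2 ≈ (x ^ᴱ 2 ⊕ y ^ᴱ 2) ⊕ (x * y ⊕ x * y)
    expand = solve 2 (λ x y →
        (x :+ y) :* ((x :+ y) :* con 1)
      := (x :* (x :* con 1) :+ y :* (y :* con 1)) :+ (x :* y :+ x :* y))
      refl x y

  additive-* : ∀ {m n} → Additive m → Additive n → Additive (m ℕ.* n)
  additive-* {m} {n} additive-m additive-n x y = begin
    (x ⊕ y) ^ᴱ (m ℕ.* n)                 ≈⟨ ^-assocʳ (x ⊕ y) m n ⟨
    ((x ⊕ y) ^ᴱ m) ^ᴱ n                  ≈⟨ ^-congˡ n (additive-m x y) ⟩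
    (x ^ᴱ m ⊕ y ^ᴱ m) ^ᴱ n               ≈⟨ additive-n (x ^ᴱ m) (y ^ᴱ m) ⟩
    (x ^ᴱ m) ^ᴱ n ⊕ (y ^ᴱ m) ^ᴱ n        ≈⟨ +-cong (^-assocʳ x m n) (^-assocʳ y m n) ⟩
    x ^ᴱ (m ℕ.* n) ⊕ y ^ᴱ (m ℕ.* n)      ∎

  additive-^ : ∀ {n} → Additive n → ∀ k → Additive (n ^ k)
  additive-^ additive-n zero    = additive-1
  additive-^ {n} additive-n (suc k) = additive-* {n} additive-n (additive-^ additive-n k)

  additive⇒^-preserves-≈0 : ∀ {n} → Additive n → .{{_ : NonZero n}} → ∀ {u v} →
    u ⊕ v ≈ 0# → u ^ᴱ n ⊕ v ^ᴱ n ≈ 0#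
  additive⇒^-preserves-≈0 {n} additive-n {u} {v} u⊕v≈0 =
    trans (sym (additive-n u v)) (x≈0⇒x^n≈0 n u⊕v≈0)

  IsRoot⇒[x⊕y]*[a*[x⊕y]⊕b]≈0 : ∀ {a b c x y} → IsRoot a b c x → IsRoot a b c y →
                                 (x ⊕ y) * (a * (x ⊕ y) ⊕ b) ≈ 0#
  IsRoot⇒[x⊕y]*[a*[x⊕y]⊕b]≈0 {a} {b} {c} {x} {y} x-root y-root =
    trans (≈-modulo-doubles c (a * x * y) expand) (trans (+-cong x-root y-root) (+-identityʳ 0#))
    where
    expand : (x ⊕ y) * (a * (x ⊕ y) ⊕ b) ⊕ (c ⊕ c)
           ≈ (a * (x * x) ⊕ b * x ⊕ c ⊕ (a * (y * y) ⊕ b * y ⊕ c)) ⊕ (a * x * y ⊕ a * x * y)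
    expand = solve 5 (λ a b c x y →
        (x :+ y) :* (a :* (x :+ y) :+ b) :+ (c :+ c)
      := (a :* (x :* x) :+ b :* x :+ c :+ (a :* (y :* y) :+ b :* y :+ c)) :+ (a :* x :* y :+ a :* x :* y))
      refl a b c x y

  module _ (R-domain : IsIntegralDomain R) where
    open IsIntegralDomain R-domain using (zero-product)
    open IntegralDomainProperties R-domain using (*-almostCancelˡ)

    at-most-two-roots : ∀ {a b c} → ¬ a ≈ 0# → ∀ x y z →
      IsRoot a b c x → IsRoot a b c y → IsRoot a b c z → x ≈ y ⊎ x ≈ z ⊎ y ≈ z
    at-most-two-roots {a} {b} a≉0 x y z x-root y-root z-root
      with zero-product _ _ (IsRoot⇒[x⊕y]*[a*[x⊕y]⊕b]≈0 x-root y-root)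
         | zero-product _ _ (IsRoot⇒[x⊕y]*[a*[x⊕y]⊕b]≈0 x-root z-root)
    ... | inj₁ x⊕y≈0 | _          = inj₁ (x⊕y≈0⇒x≈y x⊕y≈0)
    ... | inj₂ _     | inj₁ x⊕z≈0 = inj₂ (inj₁ (x⊕y≈0⇒x≈y x⊕z≈0))
    ... | inj₂ xy≈0  | inj₂ xz≈0  =
      inj₂ (inj₂ (+-cancelˡ x y z (*-almostCancelˡ a _ _ a≉0 a[x⊕y]≈a[x⊕z])))
      where
      a[x⊕y]≈a[x⊕z] : a * (x ⊕ y) ≈ a * (x ⊕ z)
      a[x⊕y]≈a[x⊕z] = +-cancelʳ b _ _ (trans xy≈0 (sym xz≈0))

module ConjugateElimination {r ℓ} (R : CommutativeRing r ℓ) (char2 : Characteristic2 R) (m : ℕ) where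
  open CommutativeRing R renaming (_+_ to _⊕_)
  open RingProperties R
  open Characteristic2Properties R char2
  open import Algebra.Solver.Ring.NaturalCoefficients.Default commutativeSemiring
    using (solve; _:+_; _:*_; _:=_; con)
  open import Relation.Binary.Reasoning.Setoid setoid

  q Q : ℕ
  q = 2 ^ m
  Q = q ^ 2

  instance
    q≢0 : NonZero q
    q≢0 = ℕₚ.m^n≢0 2 m
    Q≢0 : NonZero Q
    Q≢0 = ℕₚ.m^n≢0 q 2

  additive-q : Additive q
  additive-q = additive-^ {2} additive-2 m

  additive-Q : Additive Q
  additive-Q = additive-^ {q} additive-q 2

  module _ {α β lam s : Carrier}
           (lam^[q+1]≈1 : lam ^ᴱ (q + 1) ≈ 1#)
           (s-root : s ^ᴱ (q + 1) ⊕ α * s ⊕ β ≈ 0#)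
           (s^[Q+1]≈lam : s ^ᴱ (Q + 1) ≈ lam) where

    s^q*s-root : s ^ᴱ q * s ⊕ α * s ⊕ β ≈ 0#
    s^q*s-root = trans (+-congʳ (+-congʳ (sym (x^[n+1]≈x^n*x s q)))) s-root

    s^Q*s≈lam : s ^ᴱ Q * s ≈ lam
    s^Q*s≈lam = trans (sym (x^[n+1]≈x^n*x s Q)) s^[Q+1]≈lam

    conjugate-equation : 1# ⊕ α ^ᴱ Q * lam * s ^ᴱ q ⊕ β ^ᴱ Q * (s ^ᴱ q * s) ≈ 0#
    conjugate-equation = begin
      1# ⊕ a * lam * y ⊕ b * (y * s)
        ≈⟨ +-congʳ (+-cong (sym (trans (*-cong W*y≈lam^q s^Q*s≈lam) lam^q*lam≈1))
                           (*-congʳ (*-congˡ (sym s^Q*s≈lam)))) ⟩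
      (W * y) * (w * s) ⊕ a * (w * s) * y ⊕ b * (y * s)
        ≈⟨ factor ⟩
      (W * w ⊕ a * w ⊕ b) * (y * s)
        ≈⟨ *-congʳ Q-th-power ⟩
      0# * (y * s)
        ≈⟨ zeroˡ _ ⟩
      0# ∎
      where
      y w W a b : Carrier
      y = s ^ᴱ q
      w = s ^ᴱ Q
      W = w ^ᴱ q
      a = α ^ᴱ Q
      b = β ^ᴱ Q
      W*y≈lam^q : W * y ≈ lam ^ᴱ q
      W*y≈lam^q = trans (sym (^-distrib-* w s q)) (^-congˡ q s^Q*s≈lam)
      lam^q*lam≈1 : lam ^ᴱ q * lam ≈ 1#
      lam^q*lam≈1 = trans (sym (x^[n+1]≈x^n*x lam q)) lam^[q+1]≈1
      Q-th-power : W * w ⊕ a * w ⊕ b ≈ 0#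
      Q-th-power = begin
        W * w ⊕ a * w ⊕ b                         ≈⟨ +-congʳ (+-congʳ (*-congʳ (^-comm-^ s q Q))) ⟨
        y ^ᴱ Q * w ⊕ a * w ⊕ b                    ≈⟨ +-congʳ (+-cong (^-distrib-* y s Q) (^-distrib-* α s Q)) ⟨
        (y * s) ^ᴱ Q ⊕ (α * s) ^ᴱ Q ⊕ β ^ᴱ Q      ≈⟨ +-congʳ (additive-Q (y * s) (α * s)) ⟨
        (y * s ⊕ α * s) ^ᴱ Q ⊕ β ^ᴱ Q             ≈⟨ additive⇒^-preserves-≈0 {Q} additive-Q s^q*s-root ⟩
        0#                                        ∎
      factor : (W * y) * (w * s) ⊕ a * (w * s) * y ⊕ b * (y * s) ≈ (W * w ⊕ a * w ⊕ b) * (y * s)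
      factor = solve 6 (λ W y w s a b →
          (W :* y) :* (w :* s) :+ a :* (w :* s) :* y :+ b :* (y :* s)
        := (W :* w :+ a :* w :+ b) :* (y :* s))
        refl W y w s a b

    -- The multipliers in combine make every term containing s ^ᴱ q occur twice.
    quadratic-equation : IsRoot (β ^ᴱ Q * α) (1# ⊕ α ^ᴱ Q * lam * α ⊕ β ^ᴱ Q * β) (α ^ᴱ Q * lam * β) s
    quadratic-equation = trans (sym (x⊕[y⊕y]≈x _ doubled)) (trans combine vanishes)
      where
      y a b doubled : Carrier
      y = s ^ᴱ q
      a = α ^ᴱ Q
      b = β ^ᴱ Q
      doubled = a * lam * s * y ⊕ b * s * s * y
      combine : b * α * (s * s) ⊕ (1# ⊕ a * lam * α ⊕ b * β) * s ⊕ a * lam * β ⊕ (doubled ⊕ doubled)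
              ≈ s * (1# ⊕ a * lam * y ⊕ b * (y * s)) ⊕ (a * lam ⊕ b * s) * (y * s ⊕ α * s ⊕ β)
      combine = solve 7 (λ a b α β lam s y →
          b :* α :* (s :* s) :+ (con 1 :+ a :* lam :* α :+ b :* β) :* s :+ a :* lam :* β
            :+ ((a :* lam :* s :* y :+ b :* s :* s :* y) :+ (a :* lam :* s :* y :+ b :* s :* s :* y))
        := s :* (con 1 :+ a :* lam :* y :+ b :* (y :* s)) :+ (a :* lam :+ b :* s) :* (y :* s :+ α :* s :+ β))
        refl a b α β lam s y
      vanishes : s * (1# ⊕ a * lam * y ⊕ b * (y * s)) ⊕ (a * lam ⊕ b * s) * (y * s ⊕ α * s ⊕ β) ≈ 0#
      vanishes = trans (+-cong (trans (*-congˡ conjugate-equation) (zeroʳ s))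
                               (trans (*-congˡ s^q*s-root) (zeroʳ _)))
                       (+-identityʳ 0#)

    quadratic-equation-α≈0 : α ≈ 0# → IsRoot (β ^ᴱ q) 0# (lam * β) s
    quadratic-equation-α≈0 α≈0 = begin
      β ^ᴱ q * (s * s) ⊕ 0# * s ⊕ lam * β          ≈⟨ +-congʳ (trans (+-congˡ (zeroˡ s)) (+-identityʳ _)) ⟩
      β ^ᴱ q * (s * s) ⊕ lam * β                   ≈⟨ +-congˡ (*-cong (sym s^Q*s≈lam) (sym y*s≈β)) ⟩
      β ^ᴱ q * (s * s) ⊕ (w * s) * (y * s)         ≈⟨ factor ⟩
      (s * s) * (w * y ⊕ β ^ᴱ q)                   ≈⟨ *-congˡ q-th-power ⟩
      (s * s) * 0#                                 ≈⟨ zeroʳ _ ⟩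
      0#                                           ∎
      where
      y w : Carrier
      y = s ^ᴱ q
      w = s ^ᴱ Q
      y*s⊕β≈0 : y * s ⊕ β ≈ 0#
      y*s⊕β≈0 = trans (+-congʳ (sym α*s-vanishes)) s^q*s-root
        where
        α*s-vanishes : y * s ⊕ α * s ≈ y * s
        α*s-vanishes = trans (+-congˡ (trans (*-congʳ α≈0) (zeroˡ s))) (+-identityʳ _)
      y*s≈β : y * s ≈ β
      y*s≈β = x⊕y≈0⇒x≈y y*s⊕β≈0
      q-th-power : w * y ⊕ β ^ᴱ q ≈ 0#
      q-th-power = begin
        w * y ⊕ β ^ᴱ q           ≈⟨ +-congʳ (*-congʳ y^q≈w) ⟨
        y ^ᴱ q * y ⊕ β ^ᴱ q      ≈⟨ +-congʳ (^-distrib-* y s q) ⟨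
        (y * s) ^ᴱ q ⊕ β ^ᴱ q    ≈⟨ additive⇒^-preserves-≈0 {q} additive-q y*s⊕β≈0 ⟩
        0#                       ∎
        where
        y^q≈w : y ^ᴱ q ≈ w
        y^q≈w = trans (^-assocʳ s q q) (^-congʳ s (≡.cong (q ℕ.*_) (≡.sym (ℕₚ.*-identityʳ q))))
      factor : β ^ᴱ q * (s * s) ⊕ (w * s) * (y * s) ≈ (s * s) * (w * y ⊕ β ^ᴱ q)
      factor = solve 4 (λ βq s w y →
          βq :* (s :* s) :+ (w :* s) :* (y :* s) := (s :* s) :* (w :* y :+ βq))
        refl (β ^ᴱ q) s w y

  module _ (R-domain : IsIntegralDomain R) where
    open IntegralDomainProperties R-domain using (x≉0∧y≉0⇒x*y≉0; x≉0⇒x^n≉0)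

    solutions-are-roots-of-a-quadratic : ∀ {α β lam} → Dec (α ≈ 0#) → ¬ β ≈ 0# → lam ^ᴱ (q + 1) ≈ 1# →
      ∃[ a ] ∃[ b ] ∃[ c ] (¬ a ≈ 0# × (∀ {s} → s ^ᴱ (q + 1) ⊕ α * s ⊕ β ≈ 0# → s ^ᴱ (Q + 1) ≈ lam →
                                                 IsRoot a b c s))
    solutions-are-roots-of-a-quadratic (yes α≈0) β≉0 lam^[q+1]≈1 =
      _ , _ , _ , x≉0⇒x^n≉0 q β≉0 ,
      λ s-root s^[Q+1]≈lam → quadratic-equation-α≈0 lam^[q+1]≈1 s-root s^[Q+1]≈lam α≈0
    solutions-are-roots-of-a-quadratic (no α≉0) β≉0 lam^[q+1]≈1 =
      _ , _ , _ , x≉0∧y≉0⇒x*y≉0 (x≉0⇒x^n≉0 Q β≉0) α≉0 , quadratic-equation lam^[q+1]≈1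

theorem3p2 : {c ℓ : Level} (m : ℕ) → 1 ≤ m →
    (E : CommutativeRing c ℓ) →
    FiniteFieldOfOrder E ((2 ^ m) ^ 4) →
    let open CommutativeRing E renaming (_+_ to _⊕_)
        open Setup E (2 ^ m)
        q = 2 ^ m
    in (α β lam : Carrier) →
       Inℙ β →
       (α ^ᴱ (q + 1)) ≈ ((β ^ᴱ q) ⊕ (β ^ᴱ (q ^ 2 + q + 1))) →
       InS lam →
       (x y z : Carrier) →
       Solution α β lam x → Solution α β lam y → Solution α β lam z →
       (x ≈ y) ⊎ (x ≈ z) ⊎ (y ≈ z)
theorem3p2 (suc m) (s≤s z≤n) E E-finite α β lam β∈ℙ _ (_ , lam^[q+1]≈1) x y z
  (_ , x-root , x^[Q+1]≈lam) (_ , y-root , y^[Q+1]≈lam) (_ , z-root , z^[Q+1]≈lam) =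
  let (_ , _ , _ , a≉0 , roots) =
        solutions-are-roots-of-a-quadratic isIntegralDomain (α ≟ 0#) β≉0 lam^[q+1]≈1
  in  at-most-two-roots isIntegralDomain a≉0 x y z
        (roots x-root x^[Q+1]≈lam) (roots y-root y^[Q+1]≈lam) (roots z-root z^[Q+1]≈lam)
  where
  open CommutativeRing E using (_≈_; 0#)
  open FiniteFieldProperties E-finite
  open IntegralDomainProperties isIntegralDomain using (x^n≈1⇒x≉0)
  char2 : Characteristic2 E
  char2 = even-order⇒characteristic2 (2 ^ m ℕ.* (2 ^ suc m) ^ 3) (ℕₚ.*-assoc 2 (2 ^ m) ((2 ^ suc m) ^ 3))
  open ConjugateElimination E char2 (suc m)
  open Characteristic2Properties E char2 using (at-most-two-roots)
  β≉0 : ¬ β ≈ 0#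
  β≉0 = x^n≈1⇒x≉0 (q ^ 3 + q ^ 2 + q + 1) {{≢-nonZero (ℕₚ.m+1+n≢0 _)}} β∈ℙ
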